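{- Let $A\subset\mathbb{R}$ be a finite convex set. Then for every $d\in\mathbb{R}\setminus\{0\}$, $r_{A-A}(d) \le \lfloor |A|/2 \rfloor$.
   Context: A finite set $A=\{a_1<a_2<\dots<a_n\} \subset \mathbb{R}$ is called convex if its consecutive differences are strictly increasing, i.e. $a_i - a_{i-1} < a_{i+1}-a_i$ for all $2 \le i \le n-1$. For $x\in\mathbb{R}$, $r_{A-A}(x) = |\{(a,b)\in A\times A : a-b=x\}|$. -}

module Defs where

open import Data.Nat using (ℕ; suc)
open import Data.Fin using (Fin; toℕ) renaming (_<_ to _<ᶠ_)
open import Data.List using (List; length; filter; cartesianProduct; allFin)
open import Data.Product using (Σ; ∃; _×_; _,_; proj₁; proj₂)
open import Data.Sum using (_⊎_; inj₁; inj₂)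
open import Data.Empty using (⊥)
open import Relation.Nullary using (¬_; Dec; yes; no)
open import Relation.Binary.PropositionalEquality using (_≡_; _≢_; refl; sym)

record RealNumbers : Set₁ where
  infixl 6 _+_ _-_
  infixl 7 _*_
  infix 4 _<_ _≤_
  field
    ℝ : Set
    0ℝ 1ℝ : ℝ
    _+_ _*_ : ℝ → ℝ → ℝ
    -_ : ℝ → ℝ
    _<_ : ℝ → ℝ → Set
    +-assoc : ∀ x y z → (x + y) + z ≡ x + (y + z)
    +-comm : ∀ x y → x + y ≡ y + x
    +-identityʳ : ∀ x → x + 0ℝ ≡ x
    +-inverseʳ : ∀ x → x + (- x) ≡ 0ℝ
    *-assoc : ∀ x y z → (x * y) * z ≡ x * (y * z)
    *-comm : ∀ x y → x * y ≡ y * x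
    *-identityʳ : ∀ x → x * 1ℝ ≡ x
    distribˡ : ∀ x y z → x * (y + z) ≡ x * y + x * z
    0≢1 : 0ℝ ≢ 1ℝ
    *-inverse : ∀ x → x ≢ 0ℝ → ∃ λ y → x * y ≡ 1ℝ
    <-irrefl : ∀ x → ¬ (x < x)
    <-trans : ∀ {x y z} → x < y → y < z → x < z
    <-trichotomy : ∀ x y → x < y ⊎ (x ≡ y ⊎ y < x)
    +-monoˡ-< : ∀ {x y} z → x < y → x + z < y + z
    *-pos : ∀ {x y} → 0ℝ < x → 0ℝ < y → 0ℝ < x * y
  _≤_ : ℝ → ℝ → Set
  x ≤ y = x < y ⊎ x ≡ y
  _-_ : ℝ → ℝ → ℝ
  x - y = x + (- y)
  field
    complete : (P : ℝ → Set) → (∃ λ x → P x) → (∃ λ u → ∀ x → P x → x ≤ u) →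
               ∃ λ s → (∀ x → P x → x ≤ s) × (∀ u → (∀ x → P x → x ≤ u) → s ≤ u)

  _≟_ : (x y : ℝ) → Dec (x ≡ y)
  x ≟ y with <-trichotomy x y
  ... | inj₁ x<y = no λ { refl → <-irrefl x x<y }
  ... | inj₂ (inj₁ x≡y) = yes x≡y
  ... | inj₂ (inj₂ y<x) = no λ { refl → <-irrefl x y<x }

module _ (R : RealNumbers) where
  open RealNumbers R

  -- A = {a 0 < a 1 < ... < a (n-1)} given by its increasing enumeration
  StrictlyIncreasing : (n : ℕ) → (Fin n → ℝ) → Set
  StrictlyIncreasing n a = ∀ i j → i <ᶠ j → a i < a j

  ConvexSeq : (n : ℕ) → (Fin n → ℝ) → Set
  ConvexSeq n a = ∀ (i j k : Fin n) → toℕ j ≡ suc (toℕ i) → toℕ k ≡ suc (toℕ j) →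
                  a j - a i < a k - a j

  -- r_{A-A}(x) = #{(p,q) ∈ A × A : p - q = x}, counted over index pairs
  -- (a is injective, so index pairs correspond to element pairs)
  rDiff : (n : ℕ) → (Fin n → ℝ) → ℝ → ℕ
  rDiff n a x = length (filter (λ pq → (a (proj₁ pq) - a (proj₂ pq)) ≟ x)
                               (cartesianProduct (allFin n) (allFin n)))

{-# OPTIONS --safe #-}
module Submission where

-- For d > 0 the solutions (p , q) of a p - a q = d, read as index intervals [q , p] and listed
-- lexicographically, have strictly increasing right ends and strictly decreasing lengths: by
-- convexity, of two windows of the same length the one further right has the larger rise.
-- If there are k of them, the first has length at least k and right end at most n - k, so
-- 2k ≤ n.  Negative d is the mirror image, with intervals [p , q].

open import Defs
open import Algebra.Bundles using (AbelianGroup)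
open import Algebra.Structures using (IsAbelianGroup)
open import Algebra.Consequences.Propositional using (comm∧idʳ⇒id; comm∧invʳ⇒inv)
import Algebra.Properties.AbelianGroup as AbelianGroupProperties
open import Data.Sum using (inj₁; inj₂)
open import Data.Empty using (⊥-elim)
open import Function using (_∘_)
open import Level using (0ℓ)
open import Relation.Nullary using (Dec; yes; no; contradiction)
open import Relation.Binary.PropositionalEquality

module RealNumbersProperties (R : RealNumbers) where
  open RealNumbers R

  +-isAbelianGroup : IsAbelianGroup _≡_ _+_ 0ℝ (λ x → - x)
  +-isAbelianGroup = record
    { isGroup = record
      { isMonoid = record
        { isSemigroup = record
          { isMagma = record { isEquivalence = isEquivalence ; ∙-cong = cong₂ _+_ }
          ; assoc = +-assoc
          }
        ; identity = comm∧idʳ⇒id +-comm +-identityʳ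
        }
      ; inverse = comm∧invʳ⇒inv +-comm +-inverseʳ
      ; ⁻¹-cong = cong (λ x → - x)
      }
    ; comm = +-comm
    }

  +-abelianGroup : AbelianGroup 0ℓ 0ℓ
  +-abelianGroup = record { isAbelianGroup = +-isAbelianGroup }

  open AbelianGroupProperties +-abelianGroup
    using (∙-cancelˡ; ∙-cancelʳ; ⁻¹-injective; ⁻¹-anti-homo‿-; //-rightDividesˡ; xyx⁻¹≈y; ε⁻¹≈ε)
  open AbelianGroup +-abelianGroup using (identityˡ)

  -‿cancelˡ : ∀ x y z → x - y ≡ x - z → y ≡ z
  -‿cancelˡ x y z = ⁻¹-injective ∘ ∙-cancelˡ x (- y) (- z)

  -‿cancelʳ : ∀ z x y → x - z ≡ y - z → x ≡ y
  -‿cancelʳ z = ∙-cancelʳ (- z)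

  neg-sub : ∀ x y → - (x - y) ≡ y - x
  neg-sub = ⁻¹-anti-homo‿-

  -‿telescope : ∀ x y z → (z - y) + (y - x) ≡ z - x
  -‿telescope x y z = begin
    (z - y) + (y + - x)  ≡⟨ sym (+-assoc (z - y) y (- x)) ⟩
    ((z - y) + y) - x    ≡⟨ cong (_- x) (//-rightDividesˡ y z) ⟩
    z - x                ∎
    where open ≡-Reasoning

  <⇒≢ : ∀ {x y} → x < y → x ≢ y
  <⇒≢ {x} x<y refl = <-irrefl x x<y

  <-≤-trans : ∀ {x y z} → x < y → y ≤ z → x < z
  <-≤-trans x<y (inj₁ y<z) = <-trans x<y y<z
  <-≤-trans x<y (inj₂ refl) = x<y

  +-monoʳ-< : ∀ {x y} z → x < y → z + x < z + y
  +-monoʳ-< {x} {y} z x<y = subst₂ _<_ (+-comm x z) (+-comm y z) (+-monoˡ-< z x<y)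

  +-mono-< : ∀ {x x′ y y′} → x < x′ → y < y′ → x + y < x′ + y′
  +-mono-< {x′ = x′} {y = y} x<x′ y<y′ = <-trans (+-monoˡ-< y x<x′) (+-monoʳ-< x′ y<y′)

  x<y⇒x-y<0 : ∀ {x y} → x < y → x - y < 0ℝ
  x<y⇒x-y<0 {x} {y} x<y = subst (x - y <_) (+-inverseʳ y) (+-monoˡ-< (- y) x<y)

  x<y⇒0<y-x : ∀ {x y} → x < y → 0ℝ < y - x
  x<y⇒0<y-x {x} {y} x<y = subst (_< y - x) (+-inverseʳ x) (+-monoˡ-< (- x) x<y)

  -‿antimono-< : ∀ {x y} → x < y → - y < - x
  -‿antimono-< {x} {y} x<y =
    subst₂ _<_ (identityˡ (- y)) (xyx⁻¹≈y y (- x)) (+-monoˡ-< (- y) (x<y⇒0<y-x x<y))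

  -‿mono-< : ∀ {x x′ y y′} → x′ < x → y < y′ → x′ - y′ < x - y
  -‿mono-< x′<x y<y′ = +-mono-< x′<x (-‿antimono-< y<y′)

  -‿monoˡ-≤ : ∀ {x y} z → x ≤ y → x - z ≤ y - z
  -‿monoˡ-≤ z (inj₁ x<y) = inj₁ (+-monoˡ-< (- z) x<y)
  -‿monoˡ-≤ z (inj₂ refl) = inj₂ refl

  x<0⇒0<-x : ∀ {x} → x < 0ℝ → 0ℝ < - x
  x<0⇒0<-x x<0 = subst (_< _) ε⁻¹≈ε (-‿antimono-< x<0)

open import Data.Nat using (ℕ; zero; suc; _+_; _∸_; _*_; _/_; _<_; _≤_; z≤n; s≤s; z<s; _<?_)
import Data.Nat.Properties as ℕ
open import Data.Nat.DivMod using (m*n/n≡m; /-monoˡ-≤)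
open import Data.Fin using (Fin; toℕ; fromℕ<) renaming (_<_ to _<ᶠ_)
open import Data.Fin.Properties using (toℕ<n; toℕ-fromℕ<; fromℕ<-toℕ)
open import Data.Product as Product using (_×_; _,_; proj₁; proj₂; swap)
open import Data.Product.Relation.Binary.Lex.Strict using (×-Lex)
open import Data.List using (List; []; _∷_; length; map; filter; cartesianProduct; allFin)
open import Data.List.Properties using (length-map)
open import Data.List.Relation.Unary.All as All using (All; []; _∷_)
import Data.List.Relation.Unary.All.Properties as Allₚ
open import Data.List.Relation.Unary.AllPairs as AllPairs using (AllPairs; []; _∷_)
import Data.List.Relation.Unary.AllPairs.Properties as AllPairsₚ
open import Relation.Binary using (tri<; tri≈; tri>)

module _ {A B : Set} where

  cartesianProduct-lex : ∀ {R : A → A → Set} {S : B → B → Set} {xs ys} →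
                         AllPairs R xs → AllPairs S ys →
                         AllPairs (×-Lex _≡_ R S) (cartesianProduct xs ys)
  cartesianProduct-lex [] _ = []
  cartesianProduct-lex {R = R} {S} {x ∷ xs} {ys} (x<xs ∷ xs-sorted) ys-sorted =
    AllPairsₚ.++⁺ (AllPairsₚ.map⁺ (AllPairs.map (λ y<y′ → inj₂ (refl , y<y′)) ys-sorted))
                  (cartesianProduct-lex xs-sorted ys-sorted)
                  (Allₚ.map⁺ (All.tabulate λ {y} _ → below-later-rows y))
    where
    below-later-rows : ∀ y → All (×-Lex _≡_ R S (x , y)) (cartesianProduct xs ys)
    below-later-rows y = Allₚ.cartesianProduct⁺ (setoid A) (setoid B) xs ys
                           (λ x′∈xs _ → inj₁ (All.lookup x<xs x′∈xs))

module _ {A : Set} where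

  AllPairs-discharge : ∀ {P : A → Set} {S : A → A → Set} {xs} → All P xs →
                       AllPairs (λ x y → P x → P y → S x y) xs → AllPairs S xs
  AllPairs-discharge [] [] = []
  AllPairs-discharge (px ∷ pxs) (sx ∷ sxs) =
    All.zipWith (λ (s , py) → s px py) (sx , pxs) ∷ AllPairs-discharge pxs sxs

Interval : ℕ → ℕ × ℕ → Set
Interval n (i , j) = i < j × j < n

width : ℕ × ℕ → ℕ
width (i , j) = j ∸ i

ShorterToTheRight : ℕ × ℕ → ℕ × ℕ → Set
ShorterToTheRight x y = proj₂ x < proj₂ y × width y < width x

module _ {n : ℕ} where

  length<width : ∀ x xs → All (Interval n) (x ∷ xs) → AllPairs ShorterToTheRight (x ∷ xs) →
                 length xs < width x
  length<width (i , j) [] ((i<j , _) ∷ []) _ = ℕ.m<n⇒0<n∸m i<j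
  length<width x (y ∷ ys) (_ ∷ intervals) (((_ , y-shorter) ∷ _) ∷ sorted) =
    ℕ.≤-trans (s≤s (length<width y ys intervals sorted)) y-shorter

  end+length<n : ∀ x xs → All (Interval n) (x ∷ xs) → AllPairs ShorterToTheRight (x ∷ xs) →
                 proj₂ x + length xs < n
  end+length<n (_ , j) [] ((_ , j<n) ∷ []) _ = subst (_< n) (sym (ℕ.+-identityʳ j)) j<n
  end+length<n (_ , j) (y ∷ ys) (_ ∷ intervals) (((j<j′ , _) ∷ _) ∷ sorted) =
    subst (_< n) (sym (ℕ.+-suc j (length ys)))
      (ℕ.≤-<-trans (ℕ.+-monoˡ-≤ (length ys) j<j′) (end+length<n y ys intervals sorted))

  chain-length≤half : ∀ xs → All (Interval n) xs → AllPairs ShorterToTheRight xs →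
                      length xs ≤ n / 2
  chain-length≤half [] _ _ = z≤n
  chain-length≤half (x ∷ xs) intervals sorted =
    subst (_≤ n / 2) (m*n/n≡m k 2) (/-monoˡ-≤ 2 twice-length≤n)
    where
    k : ℕ
    k = length (x ∷ xs)
    twice-length≤n : k * 2 ≤ n
    twice-length≤n = begin
      k * 2        ≡⟨ ℕ.*-comm k 2 ⟩
      k + (k + 0)  ≡⟨ cong (k +_) (ℕ.+-identityʳ k) ⟩
      k + k        ≤⟨ ℕ.+-monoˡ-≤ k (ℕ.≤-trans (length<width x xs intervals sorted)
                                               (ℕ.m∸n≤m (proj₂ x) (proj₁ x))) ⟩
      proj₂ x + k  ≡⟨ ℕ.+-suc (proj₂ x) (length xs) ⟩
      suc (proj₂ x + length xs)  ≤⟨ end+length<n x xs intervals sorted ⟩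
      n            ∎
      where open ℕ.≤-Reasoning

module ConvexFunctions (R : RealNumbers) where
  open RealNumbers R renaming (_<_ to _<ℝ_; _≤_ to _≤ℝ_; _+_ to _+ℝ_)
  open RealNumbersProperties R

  module OnPrefix (n : ℕ) (f : ℕ → ℝ)
    (f-increasing : ∀ {k l} → k < l → l < n → f k <ℝ f l)
    (f-convex : ∀ k → 2 + k < n → f (1 + k) - f k <ℝ f (2 + k) - f (1 + k))
    where

    f-mono-≤ : ∀ {k l} → k ≤ l → l < n → f k ≤ℝ f l
    f-mono-≤ k≤l l<n with ℕ.m≤n⇒m<n∨m≡n k≤l
    ... | inj₁ k<l = inj₁ (f-increasing k<l l<n)
    ... | inj₂ refl = inj₂ refl

    f-injective : ∀ {k l} → k < n → l < n → f k ≡ f l → k ≡ l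
    f-injective {k} {l} k<n l<n fk≡fl with ℕ.<-cmp k l
    ... | tri< k<l _ _ = contradiction fk≡fl (<⇒≢ (f-increasing k<l l<n))
    ... | tri≈ _ k≡l _ = k≡l
    ... | tri> _ _ l<k = contradiction (sym fk≡fl) (<⇒≢ (f-increasing l<k k<n))

    step : ℕ → ℝ
    step k = f (suc k) - f k

    step-increasing : ∀ {k l} → k < l → suc l < n → step k <ℝ step l
    step-increasing {k} {suc l} (s≤s k≤l) 2+l<n with ℕ.m≤n⇒m<n∨m≡n k≤l
    ... | inj₁ k<l = <-trans (step-increasing k<l (ℕ.<-trans (ℕ.n<1+n _) 2+l<n)) (f-convex l 2+l<n)
    ... | inj₂ refl = f-convex l 2+l<n

    rise : ℕ × ℕ → ℝ
    rise (i , j) = f j - f i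

    rise-extend : ∀ i k → rise (i , suc k) ≡ rise (i , k) +ℝ step k
    rise-extend i k = trans (sym (-‿telescope (f i) (f k) (f (suc k)))) (+-comm (step k) (rise (i , k)))

    rise-shift-< : ∀ {i i′ w} → 0 < w → i < i′ → w + i′ < n → rise (i , w + i) <ℝ rise (i′ , w + i′)
    rise-shift-< {w = suc zero} _ = step-increasing
    rise-shift-< {i} {i′} {suc (suc w)} _ i<i′ 2+w+i′<n =
      subst₂ _<ℝ_ (sym (rise-extend i (suc w + i))) (sym (rise-extend i′ (suc w + i′)))
        (+-mono-< (rise-shift-< z<s i<i′ (ℕ.<-trans (ℕ.n<1+n _) 2+w+i′<n))
                  (step-increasing (ℕ.+-monoʳ-< (suc w) i<i′) 2+w+i′<n))

    positive-rise⇒interval : ∀ {i j} → i < n → j < n → 0ℝ <ℝ rise (i , j) → Interval n (i , j)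
    positive-rise⇒interval {i} {j} i<n j<n 0<rise with ℕ.<-cmp i j
    ... | tri< i<j _ _ = i<j , j<n
    ... | tri≈ _ refl _ = contradiction (+-inverseʳ (f i)) (<⇒≢ 0<rise ∘ sym)
    ... | tri> _ _ j<i = ⊥-elim (<-irrefl 0ℝ (<-trans 0<rise (x<y⇒x-y<0 (f-increasing j<i i<n))))

    equal-rise-start≡⇒end≡ : ∀ {i j i′ j′} → Interval n (i , j) → Interval n (i′ , j′) →
                             rise (i , j) ≡ rise (i′ , j′) → i ≡ i′ → j ≡ j′
    equal-rise-start≡⇒end≡ {i} (_ , j<n) (_ , j′<n) equal refl =
      f-injective j<n j′<n (-‿cancelʳ (f i) _ _ equal)

    equal-rise-end≡⇒start≡ : ∀ {i j i′ j′} → Interval n (i , j) → Interval n (i′ , j′) →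
                             rise (i , j) ≡ rise (i′ , j′) → j ≡ j′ → i ≡ i′
    equal-rise-end≡⇒start≡ {j = j} (i<j , j<n) (i′<j′ , j′<n) equal refl =
      f-injective (ℕ.<-trans i<j j<n) (ℕ.<-trans i′<j′ j′<n) (-‿cancelˡ (f j) _ _ equal)

    equal-rise-start<⇒shorter : ∀ {i j i′ j′} → Interval n (i , j) → Interval n (i′ , j′) →
                                rise (i , j) ≡ rise (i′ , j′) → i < i′ →
                                ShorterToTheRight (i , j) (i′ , j′)
    equal-rise-start<⇒shorter {i} {j} {i′} {j′} x@(i<j , j<n) y@(i′<j′ , j′<n) equal i<i′ =
      end< , width<
      where
      end< : j < j′
      end< with ℕ.<-cmp j j′
      ... | tri< j<j′ _ _ = j<j′
      ... | tri≈ _ j≡j′ _ = contradiction (equal-rise-end≡⇒start≡ x y equal j≡j′) (ℕ.<⇒≢ i<i′)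
      ... | tri> _ _ j′<j = contradiction (sym equal)
              (<⇒≢ (-‿mono-< (f-increasing j′<j j<n) (f-increasing i<i′ (ℕ.<-trans i′<j′ j′<n))))

      width< : j′ ∸ i′ < j ∸ i
      width< with j′ ∸ i′ <? j ∸ i
      ... | yes shorter = shorter
      ... | no not-shorter = contradiction equal (<⇒≢ (<-≤-trans shifted-window-larger window-within-y))
        where
        w : ℕ
        w = j ∸ i
        w+i≡j : w + i ≡ j
        w+i≡j = ℕ.m∸n+n≡m (ℕ.<⇒≤ i<j)
        w+i′≤j′ : w + i′ ≤ j′
        w+i′≤j′ = ℕ.≤-trans (ℕ.+-monoˡ-≤ i′ (ℕ.≮⇒≥ not-shorter))
                            (ℕ.≤-reflexive (ℕ.m∸n+n≡m (ℕ.<⇒≤ i′<j′)))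
        shifted-window-larger : rise (i , j) <ℝ rise (i′ , w + i′)
        shifted-window-larger = subst (λ k → rise (i , k) <ℝ rise (i′ , w + i′)) w+i≡j
          (rise-shift-< (ℕ.m<n⇒0<n∸m i<j) i<i′ (ℕ.≤-<-trans w+i′≤j′ j′<n))
        window-within-y : rise (i′ , w + i′) ≤ℝ rise (i′ , j′)
        window-within-y = -‿monoˡ-≤ (f i′) (f-mono-≤ w+i′≤j′ j′<n)

    equal-rise-end<⇒shorter : ∀ {i j i′ j′} → Interval n (i , j) → Interval n (i′ , j′) →
                              rise (i , j) ≡ rise (i′ , j′) → j < j′ →
                              ShorterToTheRight (i , j) (i′ , j′)
    equal-rise-end<⇒shorter {i} {i′ = i′} x y equal j<j′ with ℕ.<-cmp i i′
    ... | tri< i<i′ _ _ = equal-rise-start<⇒shorter x y equal i<i′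
    ... | tri≈ _ i≡i′ _ = contradiction (equal-rise-start≡⇒end≡ x y equal i≡i′) (ℕ.<⇒≢ j<j′)
    ... | tri> _ _ i′<i = contradiction j<j′ (ℕ.<⇒≯ (proj₁ (equal-rise-start<⇒shorter y x (sym equal) i′<i)))

    equal-rise-lex-start : ∀ {x y} → Interval n x → Interval n y → rise x ≡ rise y →
                           ×-Lex _≡_ _<_ _<_ x y → ShorterToTheRight x y
    equal-rise-lex-start x y equal (inj₁ i<i′) = equal-rise-start<⇒shorter x y equal i<i′
    equal-rise-lex-start x y equal (inj₂ (i≡i′ , j<j′)) =
      contradiction (equal-rise-start≡⇒end≡ x y equal i≡i′) (ℕ.<⇒≢ j<j′)

    equal-rise-lex-end : ∀ {x y} → Interval n x → Interval n y → rise x ≡ rise y →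
                         ×-Lex _≡_ _<_ _<_ (swap x) (swap y) → ShorterToTheRight x y
    equal-rise-lex-end x y equal (inj₁ j<j′) = equal-rise-end<⇒shorter x y equal j<j′
    equal-rise-lex-end x y equal (inj₂ (j≡j′ , i<i′)) =
      contradiction (equal-rise-end≡⇒start≡ x y equal j≡j′) (ℕ.<⇒≢ i<i′)

module FinExtension (R : RealNumbers) {n : ℕ} (a : Fin n → RealNumbers.ℝ R) where
  open RealNumbers R using (ℝ; 0ℝ; _-_) renaming (_<_ to _<ℝ_)

  -- Beyond the last index the value 0ℝ is junk; every lemma below only looks below n.
  extend : ℕ → ℝ
  extend k with k <? n
  ... | yes k<n = a (fromℕ< k<n)
  ... | no _ = 0ℝ

  extend-fromℕ< : ∀ {k} (k<n : k < n) → extend k ≡ a (fromℕ< k<n)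
  extend-fromℕ< {k} k<n with k <? n
  ... | yes _ = refl
  ... | no k≮n = contradiction k<n k≮n

  extend-toℕ : ∀ i → extend (toℕ i) ≡ a i
  extend-toℕ i = trans (extend-fromℕ< (toℕ<n i)) (cong a (fromℕ<-toℕ i (toℕ<n i)))

  extend-increasing : StrictlyIncreasing R n a → ∀ {k l} → k < l → l < n → extend k <ℝ extend l
  extend-increasing increasing {k} {l} k<l l<n =
    subst₂ _<ℝ_ (sym (extend-fromℕ< k<n)) (sym (extend-fromℕ< l<n))
      (increasing (fromℕ< k<n) (fromℕ< l<n)
        (subst₂ _<_ (sym (toℕ-fromℕ< k<n)) (sym (toℕ-fromℕ< l<n)) k<l))
    where
    k<n : k < n
    k<n = ℕ.<-trans k<l l<n

  extend-convex : ConvexSeq R n a →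
                  ∀ k → 2 + k < n → extend (1 + k) - extend k <ℝ extend (2 + k) - extend (1 + k)
  extend-convex convex k 2+k<n =
    subst₂ _<ℝ_ (cong₂ _-_ (sym (extend-fromℕ< 1+k<n)) (sym (extend-fromℕ< k<n)))
                (cong₂ _-_ (sym (extend-fromℕ< 2+k<n)) (sym (extend-fromℕ< 1+k<n)))
      (convex (fromℕ< k<n) (fromℕ< 1+k<n) (fromℕ< 2+k<n)
              (consecutive k<n 1+k<n) (consecutive 1+k<n 2+k<n))
    where
    1+k<n : 1 + k < n
    1+k<n = ℕ.<-trans (ℕ.n<1+n _) 2+k<n
    k<n : k < n
    k<n = ℕ.<-trans (ℕ.n<1+n _) 1+k<n
    consecutive : ∀ {m} (m<n : m < n) (1+m<n : suc m < n) →
                  toℕ (fromℕ< 1+m<n) ≡ suc (toℕ (fromℕ< m<n))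
    consecutive m<n 1+m<n = trans (toℕ-fromℕ< 1+m<n) (cong suc (sym (toℕ-fromℕ< m<n)))

module DifferenceCount (R : RealNumbers) {n : ℕ} (a : Fin n → RealNumbers.ℝ R)
  (increasing : StrictlyIncreasing R n a) (convex : ConvexSeq R n a) where
  open RealNumbers R using (ℝ; 0ℝ; -_; _-_; _≟_) renaming (_<_ to _<ℝ_)
  open RealNumbersProperties R
  open FinExtension R a
  open ConvexFunctions.OnPrefix R n extend (extend-increasing increasing) (extend-convex convex)

  IsSolution : ℝ → Fin n × Fin n → Set
  IsSolution d x = a (proj₁ x) - a (proj₂ x) ≡ d

  isSolution? : ∀ d x → Dec (IsSolution d x)
  isSolution? d x = (a (proj₁ x) - a (proj₂ x)) ≟ d

  index-pairs : List (Fin n × Fin n)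
  index-pairs = cartesianProduct (allFin n) (allFin n)

  solutions : ℝ → List (Fin n × Fin n)
  solutions d = filter (isSolution? d) index-pairs

  solutions-lex-sorted : ∀ d → AllPairs (×-Lex _≡_ _<ᶠ_ _<ᶠ_) (solutions d)
  solutions-lex-sorted d =
    AllPairsₚ.filter⁺ (isSolution? d) (cartesianProduct-lex allFin-sorted allFin-sorted)
    where
    allFin-sorted : AllPairs _<ᶠ_ (allFin n)
    allFin-sorted = AllPairsₚ.tabulate⁺-< (λ i<j → i<j)

  toℕ² : Fin n × Fin n → ℕ × ℕ
  toℕ² = Product.map toℕ toℕ

  toℕ²-lex : ∀ {x y} → ×-Lex _≡_ _<ᶠ_ _<ᶠ_ x y → ×-Lex _≡_ _<_ _<_ (toℕ² x) (toℕ² y)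
  toℕ²-lex (inj₁ p<p′) = inj₁ p<p′
  toℕ²-lex (inj₂ (p≡p′ , q<q′)) = inj₂ (cong toℕ p≡p′ , q<q′)

  solutions-bound : ∀ {d} (ι : Fin n × Fin n → ℕ × ℕ) →
                    (∀ {x} → IsSolution d x → Interval n (ι x)) →
                    (∀ {x y} → IsSolution d x → IsSolution d y →
                       ×-Lex _≡_ _<_ _<_ (toℕ² x) (toℕ² y) → ShorterToTheRight (ι x) (ι y)) →
                    rDiff R n a d ≤ n / 2
  solutions-bound {d} ι interval shorter =
    subst (_≤ n / 2) (length-map ι (solutions d))
      (chain-length≤half (map ι (solutions d))
        (Allₚ.map⁺ (All.map interval solved))
        (AllPairsₚ.map⁺ (AllPairs-discharge solved
          (AllPairs.map (λ lex sx sy → shorter sx sy (toℕ²-lex lex)) (solutions-lex-sorted d)))))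
    where
    solved : All (IsSolution d) (solutions d)
    solved = Allₚ.all-filter (isSolution? d) index-pairs

  rise-toℕ : ∀ p q → rise (toℕ q , toℕ p) ≡ a p - a q
  rise-toℕ p q = cong₂ _-_ (extend-toℕ p) (extend-toℕ q)

  positive-difference-bound : ∀ {d} → 0ℝ <ℝ d → rDiff R n a d ≤ n / 2
  positive-difference-bound {d} 0<d = solutions-bound ι interval shorter
    where
    ι : Fin n × Fin n → ℕ × ℕ
    ι = swap ∘ toℕ²
    rise-ι : ∀ {x} → IsSolution d x → rise (ι x) ≡ d
    rise-ι {p , q} solution = trans (rise-toℕ p q) solution
    interval : ∀ {x} → IsSolution d x → Interval n (ι x)
    interval {p , q} solution =
      positive-rise⇒interval (toℕ<n q) (toℕ<n p) (subst (0ℝ <ℝ_) (sym (rise-ι solution)) 0<d)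
    shorter : ∀ {x y} → IsSolution d x → IsSolution d y →
              ×-Lex _≡_ _<_ _<_ (toℕ² x) (toℕ² y) → ShorterToTheRight (ι x) (ι y)
    shorter sx sy =
      equal-rise-lex-end (interval sx) (interval sy) (trans (rise-ι sx) (sym (rise-ι sy)))

  negative-difference-bound : ∀ {d} → d <ℝ 0ℝ → rDiff R n a d ≤ n / 2
  negative-difference-bound {d} d<0 = solutions-bound toℕ² interval shorter
    where
    rise-toℕ² : ∀ {x} → IsSolution d x → rise (toℕ² x) ≡ - d
    rise-toℕ² {p , q} solution =
      trans (rise-toℕ q p) (trans (sym (neg-sub (a p) (a q))) (cong -_ solution))
    interval : ∀ {x} → IsSolution d x → Interval n (toℕ² x)
    interval {p , q} solution =
      positive-rise⇒interval (toℕ<n p) (toℕ<n q)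
        (subst (0ℝ <ℝ_) (sym (rise-toℕ² solution)) (x<0⇒0<-x d<0))
    shorter : ∀ {x y} → IsSolution d x → IsSolution d y →
              ×-Lex _≡_ _<_ _<_ (toℕ² x) (toℕ² y) → ShorterToTheRight (toℕ² x) (toℕ² y)
    shorter sx sy =
      equal-rise-lex-start (interval sx) (interval sy) (trans (rise-toℕ² sx) (sym (rise-toℕ² sy)))

mainTheorem2 : (R : RealNumbers) → (n : ℕ) → (a : Fin n → RealNumbers.ℝ R) →
               StrictlyIncreasing R n a → ConvexSeq R n a →
               (d : RealNumbers.ℝ R) → d ≢ RealNumbers.0ℝ R →
               rDiff R n a d ≤ n / 2
mainTheorem2 R n a increasing convex d d≢0 with RealNumbers.<-trichotomy R d (RealNumbers.0ℝ R)
... | inj₁ d<0 = negative-difference-bound d<0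
  where open DifferenceCount R a increasing convex
... | inj₂ (inj₁ d≡0) = contradiction d≡0 d≢0
... | inj₂ (inj₂ 0<d) = positive-difference-bound 0<d
  where open DifferenceCount R a increasing convex
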